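{- For every integer $n\ge 2$, $$2F_n=\max\{|\Theta_i(\Gamma_n)|+|\Theta_j(\Gamma_n)| : i,j\in\{1,\ldots,n\},\ i\neq j\}.$$
   Context: Fibonacci numbers: $F_0=0$, $F_1=1$, $F_{m+2}=F_{m+1}+F_m$. A Fibonacci string of length $n$ is a binary string of length $n$ with no two consecutive 1s. The Fibonacci cube $\Gamma_n$ ($n\ge1$) is the graph whose vertices are the Fibonacci strings of length $n$, two being adjacent iff they differ in exactly one coordinate. For $i\in\{1,\ldots,n\}$, $\Theta_i(\Gamma_n)$ denotes the set of edges of $\Gamma_n$ whose two endpoints differ in coordinate $i$. -}

module Defs where

open import Data.Nat using (ℕ; zero; suc; _+_)
open import Data.Bool using (Bool; true; false; _∧_; not)
open import Data.Fin using (Fin; zero; suc)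
open import Data.Vec using (Vec; []; _∷_; lookup; map)
open import Data.List using (List; []; _∷_; _++_; filter; length; concatMap)
open import Data.Product using (_×_; _,_; proj₁)
open import Relation.Nullary using (¬_)
open import Relation.Nullary.Decidable using (yes; no; Dec)
open import Relation.Unary using (Decidable)
open import Relation.Binary.PropositionalEquality using (_≡_)
open import Data.Bool using (_≟_)

fib : ℕ → ℕ
fib zero = 0
fib (suc zero) = 1
fib (suc (suc m)) = fib (suc m) + fib m

-- binary strings of length n (true = 1), coordinates indexed by Fin n
-- (coordinate i ∈ {1..n} of the paper is Fin index i-1)

allStrings : (n : ℕ) → List (Vec Bool n)
allStrings zero = [] ∷ []
allStrings (suc n) =
  Data.List.map (false ∷_) (allStrings n) ++ Data.List.map (true ∷_) (allStrings n)

isFib : {n : ℕ} → Vec Bool n → Bool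
isFib [] = true
isFib (x ∷ []) = true
isFib (x ∷ y ∷ xs) = not (x ∧ y) ∧ isFib (y ∷ xs)

fibStrings : (n : ℕ) → List (Vec Bool n)
fibStrings n = filter (λ v → isFib v ≟ true) (allStrings n)

diffPositions : {n : ℕ} → Vec Bool n → Vec Bool n → List (Fin n)
diffPositions [] [] = []
diffPositions (x ∷ u) (y ∷ v) with x ≟ y
... | yes _ = Data.List.map suc (diffPositions u v)
... | no _ = zero ∷ Data.List.map suc (diffPositions u v)

DifferExactlyAt : {n : ℕ} → Fin n → Vec Bool n → Vec Bool n → Set
DifferExactlyAt i u v = diffPositions u v ≡ (i ∷ [])

differExactlyAt? : {n : ℕ} (i : Fin n) (u v : Vec Bool n) → Dec (DifferExactlyAt i u v)
differExactlyAt? i u v = Data.List.Properties.≡-dec Data.Fin._≟_ (diffPositions u v) (i ∷ [])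
  where import Data.List.Properties; import Data.Fin

-- Θ_i(Γ_n): edges of Γ_n whose endpoints differ in coordinate i.
-- Each (unordered) edge {u,v} is represented exactly once, as the pair (u , v)
-- with u having 0 in coordinate i.
Theta : (n : ℕ) → Fin n → List (Vec Bool n × Vec Bool n)
Theta n i = filter (λ p → lookup (proj₁ p) i ≟ false)
  (filter (λ p → differExactlyAt? i (proj₁ p) (Data.Product.proj₂ p))
    (concatMap (λ u → Data.List.map (u ,_) (fibStrings n)) (fibStrings n)))
  where import Data.Product

thetaSize : (n : ℕ) → Fin n → ℕ
thetaSize n i = length (Theta n i)

-- An edge of Θ_i(Γ_n) is determined by its endpoint carrying the 1 in coordinate i, and
-- clearing a 1 in a Fibonacci string leaves a Fibonacci string; so |Θ_i(Γ_n)| is the number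
-- of Fibonacci strings of length n with a 1 in coordinate i. Splitting Fibonacci strings of
-- length n as 0u or 10u shows that this number is F_n when i is the first or the last
-- coordinate, and, by induction on n, that it never exceeds F_(n-1) + F_(n-2) = F_n.

module Submission where

open import Defs
open import Data.Nat using (ℕ; zero; suc; _+_; _*_; _≤_; _≥_; s≤s)
open import Data.Nat.Properties using (+-comm; +-identityʳ; +-mono-≤; ≤-reflexive; ≤-trans; m≤m+n; module ≤-Reasoning)
open import Data.Bool using (Bool; true; false; _∧_; not; if_then_else_; _≟_)
open import Data.Bool.Properties using (∧-comm; ∧-assoc; ∧-identityʳ; ∧-zeroʳ; ∧-conicalˡ; ∧-conicalʳ; not-involutive)
open import Data.Fin using (Fin; zero; suc; fromℕ)
import Data.Fin.Properties as Fin
open import Data.List using (List; []; _∷_; _++_; filter; length; concatMap; map)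
open import Data.Nat.ListAction using (sum)
open import Data.List.Properties using (map-cong; map-injective; ∷-injectiveʳ)
open import Data.Vec using (Vec; []; _∷_; lookup; updateAt)
open import Data.Vec.Properties using (≡-dec; updateAt-updateAt-local; updateAt-id)
open import Data.Product using (Σ; _×_; _,_)
open import Function using (_∘_; _⇔_; mk⇔; Equivalence)
open import Relation.Nullary using (¬_; contradiction)
open import Relation.Nullary.Decidable using (Dec; yes; no; does)
open import Relation.Binary using (DecidableEquality)
open import Relation.Binary.PropositionalEquality using (_≡_; refl; sym; trans; cong; cong₂; _≗_; module ≡-Reasoning)

private
  variable
    A B : Set
    n : ℕ

count : (A → Bool) → List A → ℕ
count f []       = 0
count f (x ∷ xs) = if f x then suc (count f xs) else count f xs

count-cong : {f g : A → Bool} → f ≗ g → (xs : List A) → count f xs ≡ count g xs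
count-cong f≗g []       = refl
count-cong f≗g (x ∷ xs) rewrite f≗g x = cong (λ c → if _ then suc c else c) (count-cong f≗g xs)

count-false : (xs : List A) → count (λ _ → false) xs ≡ 0
count-false []       = refl
count-false (x ∷ xs) = count-false xs

count-++ : (f : A → Bool) (xs ys : List A) → count f (xs ++ ys) ≡ count f xs + count f ys
count-++ f []       ys = refl
count-++ f (x ∷ xs) ys with f x
... | true  = cong suc (count-++ f xs ys)
... | false = count-++ f xs ys

count-map : (f : B → Bool) (g : A → B) (xs : List A) → count f (map g xs) ≡ count (f ∘ g) xs
count-map f g []       = refl
count-map f g (x ∷ xs) with f (g x)
... | true  = cong suc (count-map f g xs)
... | false = count-map f g xs

count-concatMap : (f : B → Bool) (g : A → List B) (xs : List A) →
  count f (concatMap g xs) ≡ sum (map (count f ∘ g) xs)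
count-concatMap f g []       = refl
count-concatMap f g (x ∷ xs) =
  trans (count-++ f (g x) (concatMap g xs)) (cong (count f (g x) +_) (count-concatMap f g xs))

sum-indicator : (f : A → Bool) (xs : List A) → sum (map (λ x → if f x then 1 else 0) xs) ≡ count f xs
sum-indicator f []       = refl
sum-indicator f (x ∷ xs) with f x
... | true  = cong suc (sum-indicator f xs)
... | false = sum-indicator f xs

length-filter : {P : A → Set} (P? : (x : A) → Dec (P x)) (xs : List A) →
  length (filter P? xs) ≡ count (does ∘ P?) xs
length-filter P? []       = refl
length-filter P? (x ∷ xs) with does (P? x)
... | true  = cong suc (length-filter P? xs)
... | false = length-filter P? xs

count-filter : {P : A → Set} (P? : (x : A) → Dec (P x)) (f : A → Bool) (xs : List A) →
  count f (filter P? xs) ≡ count (λ x → does (P? x) ∧ f x) xs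
count-filter P? f []       = refl
count-filter P? f (x ∷ xs) with does (P? x)
... | false = count-filter P? f xs
... | true with f x
...   | true  = cong suc (count-filter P? f xs)
...   | false = count-filter P? f xs

does-⇔ : {P Q : Set} (P? : Dec P) (Q? : Dec Q) → P ⇔ Q → does P? ≡ does Q?
does-⇔ (yes p) (yes q) P⇔Q = refl
does-⇔ (yes p) (no ¬q) P⇔Q = contradiction (Equivalence.to P⇔Q p) ¬q
does-⇔ (no ¬p) (yes q) P⇔Q = contradiction (Equivalence.from P⇔Q q) ¬p
does-⇔ (no ¬p) (no ¬q) P⇔Q = refl

does-≟-true : (b : Bool) → does (b ≟ true) ≡ b
does-≟-true false = refl
does-≟-true true  = refl

does-≟-false : (b : Bool) → does (b ≟ false) ≡ not b
does-≟-false false = refl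
does-≟-false true  = refl

∧-absorbs-implied : (a b : Bool) → (b ≡ true → a ≡ true) → a ∧ b ≡ b
∧-absorbs-implied a false _   = ∧-zeroʳ a
∧-absorbs-implied a true  b⇒a = trans (∧-identityʳ a) (b⇒a refl)

_≟ᵥ_ : DecidableEquality (Vec Bool n)
_≟ᵥ_ = ≡-dec _≟_

toggle : Vec Bool n → Fin n → Vec Bool n
toggle u i = updateAt u i not

toggle-involutive : (u : Vec Bool n) (i : Fin n) → toggle (toggle u i) i ≡ u
toggle-involutive u i = trans (updateAt-updateAt-local i u (not-involutive (lookup u i))) (updateAt-id i u)

lookup-toggle : (u : Vec Bool n) (i : Fin n) → lookup (toggle u i) i ≡ not (lookup u i)
lookup-toggle (x ∷ u) zero    = refl
lookup-toggle (x ∷ u) (suc i) = lookup-toggle u i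

count-allStrings-suc : (n : ℕ) (f : Vec Bool (suc n) → Bool) →
  count f (allStrings (suc n)) ≡ count (f ∘ (false ∷_)) (allStrings n) + count (f ∘ (true ∷_)) (allStrings n)
count-allStrings-suc n f = trans (count-++ f (map (false ∷_) (allStrings n)) (map (true ∷_) (allStrings n)))
  (cong₂ _+_ (count-map f (false ∷_) (allStrings n)) (count-map f (true ∷_) (allStrings n)))

count-allStrings-toggle : (i : Fin n) (f : Vec Bool n → Bool) →
  count f (allStrings n) ≡ count (λ w → f (toggle w i)) (allStrings n)
count-allStrings-toggle {suc n} zero f = begin
  count f (allStrings (suc n))
    ≡⟨ count-allStrings-suc n f ⟩
  count (f ∘ (false ∷_)) (allStrings n) + count (f ∘ (true ∷_)) (allStrings n)
    ≡⟨ +-comm (count (f ∘ (false ∷_)) (allStrings n)) _ ⟩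
  count (f ∘ (true ∷_)) (allStrings n) + count (f ∘ (false ∷_)) (allStrings n)
    ≡⟨ count-allStrings-suc n (λ w → f (toggle w zero)) ⟨
  count (λ w → f (toggle w zero)) (allStrings (suc n)) ∎
  where open ≡-Reasoning
count-allStrings-toggle {suc n} (suc i) f = begin
  count f (allStrings (suc n))
    ≡⟨ count-allStrings-suc n f ⟩
  count (f ∘ (false ∷_)) (allStrings n) + count (f ∘ (true ∷_)) (allStrings n)
    ≡⟨ cong₂ _+_ (count-allStrings-toggle i (f ∘ (false ∷_))) (count-allStrings-toggle i (f ∘ (true ∷_))) ⟩
  count (λ w → f (false ∷ toggle w i)) (allStrings n) + count (λ w → f (true ∷ toggle w i)) (allStrings n)
    ≡⟨ count-allStrings-suc n (λ w → f (toggle w (suc i))) ⟨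
  count (λ w → f (toggle w (suc i))) (allStrings (suc n)) ∎
  where open ≡-Reasoning

count-allStrings-≟ : (w : Vec Bool n) (p : Vec Bool n → Bool) →
  count (λ v → does (v ≟ᵥ w) ∧ p v) (allStrings n) ≡ (if p w then 1 else 0)
count-allStrings-≟ [] p = refl
count-allStrings-≟ {suc n} (false ∷ w) p =
  trans (count-allStrings-suc n (λ v → does (v ≟ᵥ (false ∷ w)) ∧ p v))
    (trans (cong₂ _+_ (count-allStrings-≟ w (p ∘ (false ∷_))) (count-false (allStrings n)))
      (+-identityʳ _))
count-allStrings-≟ {suc n} (true ∷ w) p =
  trans (count-allStrings-suc n (λ v → does (v ≟ᵥ (true ∷ w)) ∧ p v))
    (cong₂ _+_ (count-false (allStrings n)) (count-allStrings-≟ w (p ∘ (true ∷_))))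

diffPositions-self : (u : Vec Bool n) → diffPositions u u ≡ []
diffPositions-self []          = refl
diffPositions-self (false ∷ u) = cong (map suc) (diffPositions-self u)
diffPositions-self (true ∷ u)  = cong (map suc) (diffPositions-self u)

diffPositions-toggle : (u : Vec Bool n) (i : Fin n) → diffPositions u (toggle u i) ≡ i ∷ []
diffPositions-toggle (false ∷ u) zero    = cong (λ ds → zero ∷ map suc ds) (diffPositions-self u)
diffPositions-toggle (true ∷ u)  zero    = cong (λ ds → zero ∷ map suc ds) (diffPositions-self u)
diffPositions-toggle (false ∷ u) (suc i) = cong (map suc) (diffPositions-toggle u i)
diffPositions-toggle (true ∷ u)  (suc i) = cong (map suc) (diffPositions-toggle u i)

diffPositions-[] : (u v : Vec Bool n) → diffPositions u v ≡ [] → u ≡ v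
diffPositions-[] []      []      _ = refl
diffPositions-[] (x ∷ u) (y ∷ v) e with x ≟ y
... | yes refl = cong (x ∷_) (diffPositions-[] u v (map-injective Fin.suc-injective e))

map-suc≢zero∷[] : (ds : List (Fin n)) → ¬ (map {B = Fin (suc n)} suc ds ≡ zero ∷ [])
map-suc≢zero∷[] (d ∷ ds) ()

≢⇒≡not : (x y : Bool) → ¬ (x ≡ y) → y ≡ not x
≢⇒≡not false false x≢y = contradiction refl x≢y
≢⇒≡not false true  x≢y = refl
≢⇒≡not true  false x≢y = refl
≢⇒≡not true  true  x≢y = contradiction refl x≢y

diffPositions-singleton : (u v : Vec Bool n) (i : Fin n) → diffPositions u v ≡ i ∷ [] → v ≡ toggle u i
diffPositions-singleton (x ∷ u) (y ∷ v) i e with x ≟ y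
diffPositions-singleton (x ∷ u) (.x ∷ v) zero e | yes refl =
  contradiction e (map-suc≢zero∷[] (diffPositions u v))
diffPositions-singleton (x ∷ u) (.x ∷ v) (suc i) e | yes refl =
  cong (x ∷_) (diffPositions-singleton u v i (map-injective Fin.suc-injective e))
diffPositions-singleton (x ∷ u) (y ∷ v) zero e | no x≢y =
  cong₂ _∷_ (≢⇒≡not x y x≢y) (sym (diffPositions-[] u v (map-injective Fin.suc-injective (∷-injectiveʳ e))))

differExactlyAt⇔toggle : (i : Fin n) (u v : Vec Bool n) → DifferExactlyAt i u v ⇔ (v ≡ toggle u i)
differExactlyAt⇔toggle i u v = mk⇔ (diffPositions-singleton u v i) λ { refl → diffPositions-toggle u i }

isFib-false∷ : (u : Vec Bool n) → isFib (false ∷ u) ≡ isFib u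
isFib-false∷ []      = refl
isFib-false∷ (x ∷ u) = refl

isFib-tail : (x : Bool) (u : Vec Bool n) → isFib (x ∷ u) ≡ true → isFib u ≡ true
isFib-tail x []      _ = refl
isFib-tail x (y ∷ u) f = ∧-conicalʳ (not (x ∧ y)) (isFib (y ∷ u)) f

isFib-clear : (w : Vec Bool n) (i : Fin n) → isFib w ≡ true → lookup w i ≡ true → isFib (toggle w i) ≡ true
isFib-clear (x ∷ [])            zero          _ _    = refl
isFib-clear (true ∷ y ∷ w)      zero          f refl = isFib-tail true (y ∷ w) f
isFib-clear (false ∷ true ∷ w)  (suc zero)    f refl =
  trans (isFib-false∷ w) (isFib-tail true w (isFib-tail false (true ∷ w) f))
isFib-clear (true ∷ true ∷ w)   (suc zero)    ()
isFib-clear (x ∷ y ∷ w)         (suc (suc i)) f w-i = begin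
  not (x ∧ y) ∧ isFib (toggle (y ∷ w) (suc i))
    ≡⟨ cong (not (x ∧ y) ∧_) (isFib-clear (y ∷ w) (suc i) (isFib-tail x (y ∷ w) f) w-i) ⟩
  not (x ∧ y) ∧ true
    ≡⟨ ∧-identityʳ _ ⟩
  not (x ∧ y)
    ≡⟨ ∧-conicalˡ (not (x ∧ y)) (isFib (y ∷ w)) f ⟩
  true ∎
  where open ≡-Reasoning

count-fibStrings : (f : Vec Bool n → Bool) → count f (fibStrings n) ≡ count (λ v → isFib v ∧ f v) (allStrings n)
count-fibStrings {n} f = trans (count-filter (λ v → isFib v ≟ true) f (allStrings n))
  (count-cong (λ v → cong (_∧ f v) (does-≟-true (isFib v))) (allStrings n))

count-fibStrings-≟ : (w : Vec Bool n) (b : Bool) →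
  count (λ v → does (v ≟ᵥ w) ∧ b) (fibStrings n) ≡ (if isFib w ∧ b then 1 else 0)
count-fibStrings-≟ {n} w b = begin
  count (λ v → does (v ≟ᵥ w) ∧ b) (fibStrings n)
    ≡⟨ count-fibStrings {n} _ ⟩
  count (λ v → isFib v ∧ (does (v ≟ᵥ w) ∧ b)) (allStrings n)
    ≡⟨ count-cong (λ v → ∧-leftComm (isFib v) (does (v ≟ᵥ w))) (allStrings n) ⟩
  count (λ v → does (v ≟ᵥ w) ∧ (isFib v ∧ b)) (allStrings n)
    ≡⟨ count-allStrings-≟ w (λ v → isFib v ∧ b) ⟩
  (if isFib w ∧ b then 1 else 0) ∎
  where
  open ≡-Reasoning
  ∧-leftComm : (x y : Bool) → x ∧ (y ∧ b) ≡ y ∧ (x ∧ b)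
  ∧-leftComm x y = trans (sym (∧-assoc x y b)) (trans (cong (_∧ b) (∧-comm x y)) (∧-assoc y x b))

thetaSize≡lowerEndpoints : (n : ℕ) (i : Fin n) →
  thetaSize n i ≡ count (λ u → isFib u ∧ (isFib (toggle u i) ∧ not (lookup u i))) (allStrings n)
thetaSize≡lowerEndpoints n i = begin
  thetaSize n i
    ≡⟨ length-filter _ (filter _ edges) ⟩
  count _ (filter _ edges)
    ≡⟨ count-filter _ _ edges ⟩
  count isLowerEdge edges
    ≡⟨ count-concatMap isLowerEdge _ (fibStrings n) ⟩
  sum (map (λ u → count isLowerEdge (map (u ,_) (fibStrings n))) (fibStrings n))
    ≡⟨ cong sum (map-cong lowerEdgesAt (fibStrings n)) ⟩
  sum (map (λ u → if isFib (toggle u i) ∧ not (lookup u i) then 1 else 0) (fibStrings n))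
    ≡⟨ sum-indicator _ (fibStrings n) ⟩
  count (λ u → isFib (toggle u i) ∧ not (lookup u i)) (fibStrings n)
    ≡⟨ count-fibStrings {n} _ ⟩
  count (λ u → isFib u ∧ (isFib (toggle u i) ∧ not (lookup u i))) (allStrings n) ∎
  where
  open ≡-Reasoning
  edges : List (Vec Bool n × Vec Bool n)
  edges = concatMap (λ u → map (u ,_) (fibStrings n)) (fibStrings n)
  isLowerEdge : Vec Bool n × Vec Bool n → Bool
  isLowerEdge (u , v) = does (differExactlyAt? i u v) ∧ does (lookup u i ≟ false)
  lowerEdgesAt : (u : Vec Bool n) →
    count isLowerEdge (map (u ,_) (fibStrings n)) ≡ (if isFib (toggle u i) ∧ not (lookup u i) then 1 else 0)
  lowerEdgesAt u = begin
    count isLowerEdge (map (u ,_) (fibStrings n))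
      ≡⟨ count-map isLowerEdge (u ,_) (fibStrings n) ⟩
    count (λ v → isLowerEdge (u , v)) (fibStrings n)
      ≡⟨ count-cong (λ v → cong₂ _∧_ (does-⇔ (differExactlyAt? i u v) (v ≟ᵥ toggle u i) (differExactlyAt⇔toggle i u v))
                                     (does-≟-false (lookup u i))) (fibStrings n) ⟩
    count (λ v → does (v ≟ᵥ toggle u i) ∧ not (lookup u i)) (fibStrings n)
      ≡⟨ count-fibStrings-≟ (toggle u i) (not (lookup u i)) ⟩
    (if isFib (toggle u i) ∧ not (lookup u i) then 1 else 0) ∎

onesAt : (n : ℕ) → Fin n → ℕ
onesAt n i = count (λ w → isFib w ∧ lookup w i) (allStrings n)

thetaSize≡onesAt : (n : ℕ) (i : Fin n) → thetaSize n i ≡ onesAt n i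
thetaSize≡onesAt n i = begin
  thetaSize n i
    ≡⟨ thetaSize≡lowerEndpoints n i ⟩
  count (λ u → isFib u ∧ (isFib (toggle u i) ∧ not (lookup u i))) (allStrings n)
    ≡⟨ count-allStrings-toggle i _ ⟩
  count (λ w → isFib (toggle w i) ∧ (isFib (toggle (toggle w i) i) ∧ not (lookup (toggle w i) i))) (allStrings n)
    ≡⟨ count-cong upperEndpoint (allStrings n) ⟩
  onesAt n i ∎
  where
  open ≡-Reasoning
  upperEndpoint : (w : Vec Bool n) →
    isFib (toggle w i) ∧ (isFib (toggle (toggle w i) i) ∧ not (lookup (toggle w i) i)) ≡ isFib w ∧ lookup w i
  upperEndpoint w = begin
    isFib (toggle w i) ∧ (isFib (toggle (toggle w i) i) ∧ not (lookup (toggle w i) i))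
      ≡⟨ cong₂ (λ u b → isFib (toggle w i) ∧ (isFib u ∧ b))
               (toggle-involutive w i) (trans (cong not (lookup-toggle w i)) (not-involutive (lookup w i))) ⟩
    isFib (toggle w i) ∧ (isFib w ∧ lookup w i)
      ≡⟨ ∧-absorbs-implied (isFib (toggle w i)) (isFib w ∧ lookup w i)
           (λ f∧1 → isFib-clear w i (∧-conicalˡ (isFib w) _ f∧1) (∧-conicalʳ (isFib w) _ f∧1)) ⟩
    isFib w ∧ lookup w i ∎

count-isFib-∧ : (m : ℕ) (g : Vec Bool (suc (suc m)) → Bool) →
  count (λ w → isFib w ∧ g w) (allStrings (suc (suc m)))
    ≡ count (λ u → isFib u ∧ g (false ∷ u)) (allStrings (suc m))
      + count (λ u → isFib u ∧ g (true ∷ false ∷ u)) (allStrings m)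
count-isFib-∧ m g = begin
  count (λ w → isFib w ∧ g w) (allStrings (suc (suc m)))
    ≡⟨ count-allStrings-suc (suc m) _ ⟩
  count (λ u → isFib (false ∷ u) ∧ g (false ∷ u)) (allStrings (suc m))
    + count (λ u → isFib (true ∷ u) ∧ g (true ∷ u)) (allStrings (suc m))
    -- a string starting with 11 is not Fibonacci: that summand's predicate reduces to false
    ≡⟨ cong₂ _+_ (count-cong (λ u → cong (_∧ g (false ∷ u)) (isFib-false∷ u)) (allStrings (suc m)))
                 (count-allStrings-suc m _) ⟩
  count (λ u → isFib u ∧ g (false ∷ u)) (allStrings (suc m))
    + (count (λ u → isFib (false ∷ u) ∧ g (true ∷ false ∷ u)) (allStrings m) + count (λ _ → false) (allStrings m))
    ≡⟨ cong (count (λ u → isFib u ∧ g (false ∷ u)) (allStrings (suc m)) +_)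
            (trans (cong₂ _+_ (count-cong (λ u → cong (_∧ g (true ∷ false ∷ u)) (isFib-false∷ u)) (allStrings m))
                              (count-false (allStrings m)))
                   (+-identityʳ _)) ⟩
  count (λ u → isFib u ∧ g (false ∷ u)) (allStrings (suc m))
    + count (λ u → isFib u ∧ g (true ∷ false ∷ u)) (allStrings m) ∎
  where open ≡-Reasoning

count-∧-true : (f : A → Bool) (xs : List A) → count (λ x → f x ∧ true) xs ≡ count f xs
count-∧-true f = count-cong (∧-identityʳ ∘ f)

count-∧-false : (f : A → Bool) (xs : List A) → count (λ x → f x ∧ false) xs ≡ 0
count-∧-false f xs = trans (count-cong (∧-zeroʳ ∘ f) xs) (count-false xs)

count-isFib : (n : ℕ) → count isFib (allStrings n) ≡ fib (suc (suc n))
count-isFib zero          = refl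
count-isFib (suc zero)    = refl
count-isFib (suc (suc m)) = begin
  count isFib (allStrings (suc (suc m)))
    ≡⟨ count-∧-true isFib (allStrings (suc (suc m))) ⟨
  count (λ w → isFib w ∧ true) (allStrings (suc (suc m)))
    ≡⟨ count-isFib-∧ m (λ _ → true) ⟩
  count (λ u → isFib u ∧ true) (allStrings (suc m)) + count (λ u → isFib u ∧ true) (allStrings m)
    ≡⟨ cong₂ _+_ (trans (count-∧-true isFib (allStrings (suc m))) (count-isFib (suc m)))
                 (trans (count-∧-true isFib (allStrings m)) (count-isFib m)) ⟩
  fib (suc (suc (suc (suc m)))) ∎
  where open ≡-Reasoning

onesAt-zero : (n : ℕ) → onesAt (suc n) zero ≡ fib (suc n)
onesAt-zero zero    = refl
onesAt-zero (suc m) =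
  trans (count-isFib-∧ m (λ w → lookup w zero))
        (cong₂ _+_ (count-∧-false isFib (allStrings (suc m)))
                   (trans (count-∧-true isFib (allStrings m)) (count-isFib m)))

onesAt-one : (m : ℕ) → onesAt (suc (suc m)) (suc zero) ≡ fib (suc m)
onesAt-one m =
  trans (count-isFib-∧ m (λ w → lookup w (suc zero)))
        (trans (cong₂ _+_ (onesAt-zero m) (count-∧-false isFib (allStrings m))) (+-identityʳ _))

onesAt-suc-suc : (m : ℕ) (k : Fin m) → onesAt (suc (suc m)) (suc (suc k)) ≡ onesAt (suc m) (suc k) + onesAt m k
onesAt-suc-suc m k = count-isFib-∧ m (λ w → lookup w (suc (suc k)))

onesAt≤fib : (i : Fin n) → onesAt n i ≤ fib n
onesAt≤fib {suc n}       zero          = ≤-reflexive (onesAt-zero n)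
onesAt≤fib {suc (suc m)} (suc zero)    = ≤-trans (≤-reflexive (onesAt-one m)) (m≤m+n (fib (suc m)) (fib m))
onesAt≤fib {suc (suc m)} (suc (suc k)) =
  ≤-trans (≤-reflexive (onesAt-suc-suc m k)) (+-mono-≤ (onesAt≤fib (suc k)) (onesAt≤fib k))

onesAt-last : (n : ℕ) → onesAt (suc n) (fromℕ n) ≡ fib (suc n)
onesAt-last zero          = onesAt-zero zero
onesAt-last (suc zero)    = onesAt-one zero
onesAt-last (suc (suc m)) =
  trans (onesAt-suc-suc (suc m) (fromℕ m)) (cong₂ _+_ (onesAt-last (suc m)) (onesAt-last m))

proposition4p2 : (n : ℕ) → n ≥ 2 →
    (Σ (Fin n) λ i → Σ (Fin n) λ j → ¬ (i ≡ j) × (thetaSize n i + thetaSize n j ≡ 2 * fib n))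
    × ((i j : Fin n) → ¬ (i ≡ j) → thetaSize n i + thetaSize n j ≤ 2 * fib n)
proposition4p2 (suc zero) (s≤s ())
proposition4p2 n@(suc (suc m)) _ = (zero , fromℕ (suc m) , (λ ()) , ends) , λ i j _ → bound i j
  where
  double : fib n + fib n ≡ 2 * fib n
  double = cong (fib n +_) (sym (+-identityʳ (fib n)))
  ends : thetaSize n zero + thetaSize n (fromℕ (suc m)) ≡ 2 * fib n
  ends = begin
    thetaSize n zero + thetaSize n (fromℕ (suc m))
      ≡⟨ cong₂ _+_ (thetaSize≡onesAt n zero) (thetaSize≡onesAt n (fromℕ (suc m))) ⟩
    onesAt n zero + onesAt n (fromℕ (suc m))
      ≡⟨ cong₂ _+_ (onesAt-zero (suc m)) (onesAt-last (suc m)) ⟩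
    fib n + fib n
      ≡⟨ double ⟩
    2 * fib n ∎
    where open ≡-Reasoning
  bound : (i j : Fin n) → thetaSize n i + thetaSize n j ≤ 2 * fib n
  bound i j = begin
    thetaSize n i + thetaSize n j ≡⟨ cong₂ _+_ (thetaSize≡onesAt n i) (thetaSize≡onesAt n j) ⟩
    onesAt n i + onesAt n j       ≤⟨ +-mono-≤ (onesAt≤fib i) (onesAt≤fib j) ⟩
    fib n + fib n                 ≡⟨ double ⟩
    2 * fib n                     ∎
    where open ≤-Reasoning
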